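{- Let $k\geq 1$ and let $\phi = Q_1x_1\dots Q_mx_m.\psi$ be a prenex $\mathsf{SL}^k$ formula with $Q_i\in\{\forall,\exists\}$ for $i=1,\dots,m$, where $\psi$ is a quantifier-free boolean combination of domain independent test formulae. Let $V$ be the set of free variables of $\phi$. If $\mathcal{I}$ and $\mathcal{I}'$ are $\mathsf{SL}$-structures that are $(V,m)$-equivalent and $\mathcal{I}\models\phi$, then $\mathcal{I}'\models\phi$.
   Context: An $\mathsf{SL}$-structure (for $k$ selectors) is a triple $(U,s,h)$ with $U$ a countable set, $s:\mathsf{Var}\rightharpoonup U$ a store (defined on all free variables considered), and $h:U\rightharpoonup U^k$ a partial map with finite domain (the heap). Let $\mathrm{dom}(h)$ be its domain, $\mathrm{img}(h)=\{\ell_i \mid \exists \ell\in\mathrm{dom}(h),\ h(\ell)=(\ell_1,\dots,\ell_k),\ i\in[1,k]\}$, and $\mathrm{elems}(h)=\mathrm{dom}(h)\cup\mathrm{img}(h)$. The domain independent test formulae are: $x\approx y$ (true iff $s(x)=s(y)$); $x\hookrightarrow(y_1,\dots,y_k)$ (true iff $s(x)\in\mathrm{dom}(h)$ and $h(s(x))=(s(y_1),\dots,s(y_k))$); $\mathsf{alloc}(x)$ (true iff $s(x)\in\mathrm{dom}(h)$); and $|h|\geq n$ for $n\in\mathbb{N}\cup\{\infty\}$ (true iff $|\mathrm{dom}(h)|\geq n$; it is false for $n=\infty$). Quantifiers range over $U$. Given a set of variables $X$ and $n\in\mathbb{N}$, two structures $\mathcal{I}=(U,s,h)$ and $\mathcal{I}'=(U',s',h')$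 are $(X,n)$-equivalent iff: (1) $h=h'$; (2) for all $x,y\in X$, $s(x)=s(y)$ iff $s'(x)=s'(y)$; (3) for every $x\in X$, if $s(x)\in\mathrm{elems}(h)$ or $s'(x)\in\mathrm{elems}(h)$ then $s(x)=s'(x)$; (4) $|U\setminus\mathrm{elems}(h)|\geq n+|X|$ and $|U'\setminus\mathrm{elems}(h)|\geq n+|X|$. -}

module Defs where

open import Data.Nat using (ℕ; _+_; _≟_)
open import Data.Maybe using (Maybe; just; nothing)
open import Data.Vec using (Vec)
import Data.Vec as Vec
open import Data.Vec.Membership.Propositional using () renaming (_∈_ to _∈ᵥ_)
open import Data.List using (List; []; _∷_; _++_; length; filter; deduplicate)
open import Data.List.Membership.Propositional using (_∈_)
open import Data.List.Relation.Unary.All using (All)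
open import Data.List.Relation.Unary.Unique.Propositional using (Unique)
open import Data.Product using (Σ; ∃; _×_; _,_)
open import Data.Sum using (_⊎_)
open import Data.Empty using (⊥)
open import Data.Unit using (⊤)
open import Relation.Nullary using (¬_; ¬?)
open import Relation.Binary.PropositionalEquality using (_≡_)

-- Locations are natural numbers: every
-- (countable) universe U is modelled as a subset (predicate) of ℕ, so
-- that two structures with different universes can share the same heap.

Var : Set
Var = ℕ

Loc : Set
Loc = ℕ

data ℕ∞ : Set where
  fin : ℕ → ℕ∞
  ∞   : ℕ∞

Heap : ℕ → Set
Heap k = Loc → Maybe (Vec Loc k)

InDom : ∀ {k} → Heap k → Loc → Set
InDom h ℓ = ∃ λ v → h ℓ ≡ just v

InImg : ∀ {k} → Heap k → Loc → Set
InImg h ℓ = ∃ λ ℓ₀ → ∃ λ v → h ℓ₀ ≡ just v × ℓ ∈ᵥ v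

InElems : ∀ {k} → Heap k → Loc → Set
InElems h ℓ = InDom h ℓ ⊎ InImg h ℓ

FiniteDom : ∀ {k} → Heap k → Set
FiniteDom h = Σ (List Loc) λ l → ∀ ℓ → InDom h ℓ → ℓ ∈ l

-- SL-structures (U, s, h) for k selectors.
-- The store is total; "defined on the free variables considered" is
-- imposed separately (StoreIn below) by requiring s x ∈ U for those x.

record Structure (k : ℕ) : Set₁ where
  field
    U          : Loc → Set
    store      : Var → Loc
    heap       : Heap k
    heapFinite : FiniteDom heap
    heapInU    : ∀ ℓ → InElems heap ℓ → U ℓ
open Structure public

StoreIn : ∀ {k} → Structure k → List Var → Set
StoreIn I X = ∀ x → x ∈ X → U I (store I x)

data Test (k : ℕ) : Set where
  eq    : Var → Var → Test k
  pto   : Var → Vec Var k → Test k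
  alloc : Var → Test k
  size≥ : ℕ∞ → Test k

data QF (k : ℕ) : Set where
  atom  : Test k → QF k
  tt ff : QF k
  not   : QF k → QF k
  and or : QF k → QF k → QF k

data Prenex (k : ℕ) : Set where
  qf  : QF k → Prenex k
  all : Var → Prenex k → Prenex k
  ex  : Var → Prenex k → Prenex k

nQuant : ∀ {k} → Prenex k → ℕ
nQuant (qf _)    = 0
nQuant (all _ φ) = ℕ.suc (nQuant φ)
nQuant (ex _ φ)  = ℕ.suc (nQuant φ)

testVars : ∀ {k} → Test k → List Var
testVars (eq x y)    = x ∷ y ∷ []
testVars (pto x ys)  = x ∷ Vec.toList ys
testVars (alloc x)   = x ∷ []
testVars (size≥ _)   = []

qfVars : ∀ {k} → QF k → List Var
qfVars (atom t)  = testVars t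
qfVars tt        = []
qfVars ff        = []
qfVars (not ψ)   = qfVars ψ
qfVars (and ψ χ) = qfVars ψ ++ qfVars χ
qfVars (or ψ χ)  = qfVars ψ ++ qfVars χ

fv : ∀ {k} → Prenex k → List Var
fv (qf ψ)    = qfVars ψ
fv (all x φ) = filter (λ y → ¬? (y ≟ x)) (fv φ)
fv (ex x φ)  = filter (λ y → ¬? (y ≟ x)) (fv φ)

freeVars : ∀ {k} → Prenex k → List Var
freeVars φ = deduplicate _≟_ (fv φ)

_[_↦_] : (Var → Loc) → Var → Loc → (Var → Loc)
(s [ x ↦ ℓ ]) y with y ≟ x
... | Relation.Nullary.yes _ = ℓ
... | Relation.Nullary.no _  = s y

DomAtLeast : ∀ {k} → Heap k → ℕ∞ → Set
DomAtLeast h (fin n) = Σ (List Loc) λ l → Unique l × length l ≡ n × All (InDom h) l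
DomAtLeast h ∞       = ⊥

⟦_⟧T : ∀ {k} → Test k → (Var → Loc) → Heap k → Set
⟦ eq x y ⟧T   s h = s x ≡ s y
⟦ pto x ys ⟧T s h = h (s x) ≡ just (Vec.map s ys)
⟦ alloc x ⟧T  s h = InDom h (s x)
⟦ size≥ n ⟧T  s h = DomAtLeast h n

⟦_⟧Q : ∀ {k} → QF k → (Var → Loc) → Heap k → Set
⟦ atom t ⟧Q  s h = ⟦ t ⟧T s h
⟦ tt ⟧Q      s h = ⊤
⟦ ff ⟧Q      s h = ⊥
⟦ not ψ ⟧Q   s h = ¬ ⟦ ψ ⟧Q s h
⟦ and ψ χ ⟧Q s h = ⟦ ψ ⟧Q s h × ⟦ χ ⟧Q s h
⟦ or ψ χ ⟧Q  s h = ⟦ ψ ⟧Q s h ⊎ ⟦ χ ⟧Q s h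

Sat : ∀ {k} → (Loc → Set) → (Var → Loc) → Heap k → Prenex k → Set
Sat U s h (qf ψ)    = ⟦ ψ ⟧Q s h
Sat U s h (all x φ) = ∀ ℓ → U ℓ → Sat U (s [ x ↦ ℓ ]) h φ
Sat U s h (ex x φ)  = Σ Loc λ ℓ → U ℓ × Sat U (s [ x ↦ ℓ ]) h φ

_⊨_ : ∀ {k} → Structure k → Prenex k → Set
I ⊨ φ = Sat (U I) (store I) (heap I) φ

OutsideAtLeast : ∀ {k} → (Loc → Set) → Heap k → ℕ → Set
OutsideAtLeast U h N =
  Σ (List Loc) λ l → Unique l × length l ≡ N × All (λ ℓ → U ℓ × ¬ InElems h ℓ) l

record Equiv {k : ℕ} (X : List Var) (n : ℕ) (I I' : Structure k) : Set where
  field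
    sameHeap  : ∀ ℓ → heap I ℓ ≡ heap I' ℓ
    sameEqs   : ∀ x y → x ∈ X → y ∈ X →
                (store I x ≡ store I y → store I' x ≡ store I' y) ×
                (store I' x ≡ store I' y → store I x ≡ store I y)
    sameElems : ∀ x → x ∈ X →
                (InElems (heap I) (store I x) ⊎ InElems (heap I) (store I' x)) →
                store I x ≡ store I' x
    bigU      : OutsideAtLeast (U I) (heap I) (n + length X)
    bigU'     : OutsideAtLeast (U I') (heap I) (n + length X)

module Submission where

-- An Ehrenfeucht–Fraïssé style argument.  Two stores s, s'
-- over the same heap h *agree* on a set X of variables when equalities
-- between variables of X hold in s iff they hold in s', and a variable of
-- X denoting a heap element (in either store) denotes the same location in
-- both.  Agreement on the variables of a quantifier-free ψ preserves every
-- test formula, hence ψ itself (qf-transfer).  For quantifiers we carry a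
-- *correspondence*: agreement on X together with at least n + |X| unused
-- locations outside elems(h) in each universe, where n counts the
-- quantifiers still to be handled.  Any choice ℓ for a quantified variable
-- on one side has a partner ℓ' on the other (ℓ itself if it is a heap
-- element, s' y if ℓ = s y, and otherwise a fresh unused location, which
-- exists by a pigeonhole argument), and extending both stores by (ℓ, ℓ')
-- yields a correspondence on x ∷ X with one quantifier fewer.  Since the
-- correspondence is symmetric, ∀ and ∃ are handled alike (sat-transfer).
-- Proposition 1 follows, as (V, m)-equivalence provides the initial
-- correspondence and satisfaction only depends on the heap pointwise.

open import Defs
open import Data.Nat using (ℕ; suc; _≤_; _<_; _+_; s≤s; z≤n; _≟_)
open import Data.Nat.Properties using (≤-trans; <⇒≱; m≤n+m; +-suc)
open import Data.Maybe using (just; nothing)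
open import Data.Maybe.Properties using (just-injective)
open import Data.Vec using (Vec; []; _∷_)
import Data.Vec as Vec
open import Data.Vec.Membership.Propositional using () renaming (_∈_ to _∈ᵥ_)
import Data.Vec.Membership.Propositional.Properties as VecMem
import Data.Vec.Relation.Unary.Any as VecAny
open import Data.Vec.Membership.DecPropositional _≟_ using () renaming (_∈?_ to _∈ᵥ?_)
open import Data.List using (List; []; _∷_; length; filter; map)
open import Data.List.Properties using (filter-notAll; length-map)
open import Data.List.Membership.Propositional using (_∈_; _∉_; find; lose)
open import Data.List.Membership.Propositional.Properties using (∈-filter⁺; ∈-map⁺; ∈-deduplicate⁺)
open import Data.List.Membership.DecPropositional _≟_ using (_∈?_)
open import Data.List.Relation.Binary.Subset.Propositional using (_⊆_)
open import Data.List.Relation.Binary.Subset.Propositional.Properties using (xs⊆xs++ys; xs⊆ys++xs)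
open import Data.List.Relation.Unary.Any using (here; there; any?)
import Data.List.Relation.Unary.Any as Any
open import Data.List.Relation.Unary.All using (All; _∷_; all?)
import Data.List.Relation.Unary.All as All
open import Data.List.Relation.Unary.All.Properties using (¬All⇒Any¬)
open import Data.List.Relation.Unary.AllPairs using (_∷_)
open import Data.List.Relation.Unary.Unique.Propositional using (Unique)
open import Data.Product using (∃; _×_; _,_; proj₁; proj₂; swap)
open import Data.Sum using (_⊎_; inj₁; inj₂)
import Data.Sum as Sum
open import Data.Unit using (tt)
open import Function using (_∘_)
open import Relation.Nullary using (¬_; ¬?; Dec; yes; no; contradiction)
open import Relation.Binary.PropositionalEquality using (_≡_; refl; sym; trans; cong; cong₂; subst)

unique-⊆-length : (L M : List ℕ) → Unique L → All (_∈ M) L → length L ≤ length M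
unique-⊆-length []      M _              _            = z≤n
unique-⊆-length (x ∷ L) M (x∉L ∷ uniqueL) (x∈M ∷ L⊆M) =
  ≤-trans (s≤s (unique-⊆-length L (filter notX? M) uniqueL L⊆M-x))
          (filter-notAll notX? M (Any.map (λ x≡y x≢y → x≢y x≡y) x∈M))
  where
  notX? : ∀ y → Dec (¬ x ≡ y)
  notX? y = ¬? (x ≟ y)
  L⊆M-x : All (_∈ filter notX? M) L
  L⊆M-x = All.zipWith (λ (y∈M , x≢y) → ∈-filter⁺ notX? y∈M x≢y) (L⊆M , x∉L)

outside : (L M : List ℕ) → Unique L → length M < length L → ∃ λ a → a ∈ L × a ∉ M
outside L M uniqueL M<L with all? (_∈? M) L
... | yes L⊆M = contradiction (unique-⊆-length L M uniqueL L⊆M) (<⇒≱ M<L)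
... | no  L⊈M = find (¬All⇒Any¬ (_∈? M) L L⊈M)

module _ {k : ℕ} (h : Heap k) where

  Points : Loc → Loc → Set
  Points ℓ₀ ℓ = ∃ λ v → h ℓ₀ ≡ just v × ℓ ∈ᵥ v

  inDom? : ∀ ℓ → Dec (InDom h ℓ)
  inDom? ℓ with h ℓ
  ... | just v  = yes (v , refl)
  ... | nothing = no λ ()

  points? : ∀ ℓ₀ ℓ → Dec (Points ℓ₀ ℓ)
  points? ℓ₀ ℓ with h ℓ₀
  ... | nothing = no λ ()
  ... | just v with ℓ ∈ᵥ? v
  ...   | yes ℓ∈v = yes (v , refl , ℓ∈v)
  ...   | no  ℓ∉v = no λ (w , v≡w , ℓ∈w) → ℓ∉v (subst (ℓ ∈ᵥ_) (sym (just-injective v≡w)) ℓ∈w)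

  -- a cell pointing to ℓ lies in dom(h), so it suffices to search D
  inElems? : (D : List Loc) → (∀ ℓ → InDom h ℓ → ℓ ∈ D) → ∀ ℓ → Dec (InElems h ℓ)
  inElems? D dom⊆D ℓ with inDom? ℓ | any? (λ ℓ₀ → points? ℓ₀ ℓ) D
  ... | yes ℓ∈dom | _        = yes (inj₁ ℓ∈dom)
  ... | no  _     | yes hit  = let (ℓ₀ , _ , p) = find hit in yes (inj₂ (ℓ₀ , p))
  ... | no  ℓ∉dom | no  miss = no λ
    { (inj₁ ℓ∈dom)                → ℓ∉dom ℓ∈dom
    ; (inj₂ (ℓ₀ , p@(v , e , _))) → miss (lose (dom⊆D ℓ₀ (v , e)) p) }

_⊗_ : (Var → Loc) → (Var → Loc) → Var → Loc × Loc
(s ⊗ s') z = s z , s' z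

Coherent : Loc × Loc → Loc × Loc → Set
Coherent (a , a') (b , b') = (a ≡ b → a' ≡ b') × (a' ≡ b' → a ≡ b)

Faithful : ∀ {k} → Heap k → Loc × Loc → Set
Faithful h (a , a') = InElems h a ⊎ InElems h a' → a ≡ a'

record Agree {k} (h : Heap k) (X : List Var) (s s' : Var → Loc) : Set where
  field
    coherent : ∀ y z → y ∈ X → z ∈ X → Coherent ((s ⊗ s') y) ((s ⊗ s') z)
    faithful : ∀ z → z ∈ X → Faithful h ((s ⊗ s') z)
open Agree

coherent-refl : ∀ p → Coherent p p
coherent-refl _ = (λ _ → refl) , (λ _ → refl)

coherent-sym : ∀ {a a' b b'} → Coherent (a , a') (b , b') → Coherent (b , b') (a , a')
coherent-sym (to , from) = (λ e → sym (to (sym e))) , (λ e → sym (from (sym e)))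

agree-sym : ∀ {k} {h : Heap k} {X s s'} → Agree h X s s' → Agree h X s' s
agree-sym A = record
  { coherent = λ y z y∈X z∈X → swap (coherent A y z y∈X z∈X)
  ; faithful = λ z z∈X el → sym (faithful A z z∈X (Sum.swap el)) }

map-cong-∈ : ∀ {n} (s s' : Var → Loc) (zs : Vec Var n) →
  (∀ {z} → z ∈ᵥ zs → s z ≡ s' z) → Vec.map s zs ≡ Vec.map s' zs
map-cong-∈ s s' []       _  = refl
map-cong-∈ s s' (z ∷ zs) same =
  cong₂ _∷_ (same (VecAny.here refl)) (map-cong-∈ s s' zs (λ z∈zs → same (VecAny.there z∈zs)))

-- Agreement on the variables of a test formula preserves it: a points-to
-- or alloc test makes its variables heap elements, so they are fixed.
test-transfer : ∀ {k} {h : Heap k} {X s s'} (t : Test k) → Agree h X s s' →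
  testVars t ⊆ X → ⟦ t ⟧T s h → ⟦ t ⟧T s' h
test-transfer (eq x y) A vars⊆X x≡y =
  proj₁ (coherent A x y (vars⊆X (here refl)) (vars⊆X (there (here refl)))) x≡y
test-transfer {h = h} {s = s} {s'} (pto x ys) A vars⊆X x↦ys =
  trans (cong h (sym sx≡s'x)) (trans x↦ys (cong just ys-equal))
  where
  sx≡s'x : s x ≡ s' x
  sx≡s'x = faithful A x (vars⊆X (here refl)) (inj₁ (inj₁ (_ , x↦ys)))
  ys-equal : Vec.map s ys ≡ Vec.map s' ys
  ys-equal = map-cong-∈ s s' ys λ {y} y∈ys →
    faithful A y (vars⊆X (there (VecMem.∈-toList⁺ y∈ys)))
      (inj₁ (inj₂ (s x , _ , x↦ys , VecMem.∈-map⁺ s y∈ys)))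
test-transfer {h = h} (alloc x) A vars⊆X x∈dom =
  subst (InDom h) (faithful A x (vars⊆X (here refl)) (inj₁ (inj₁ x∈dom))) x∈dom
test-transfer (size≥ n) A vars⊆X big = big

-- Agreement on the variables of a quantifier-free formula preserves it;
-- negation uses the symmetry of agreement.
qf-transfer : ∀ {k} {h : Heap k} {X s s'} (ψ : QF k) → Agree h X s s' →
  qfVars ψ ⊆ X → ⟦ ψ ⟧Q s h → ⟦ ψ ⟧Q s' h
qf-transfer (atom t)  A vars⊆X sat = test-transfer t A vars⊆X sat
qf-transfer tt        A vars⊆X sat = tt
qf-transfer ff        A vars⊆X ()
qf-transfer (not ψ)   A vars⊆X sat = λ sat' → sat (qf-transfer ψ (agree-sym A) vars⊆X sat')
qf-transfer (and ψ χ) A vars⊆X (satψ , satχ) =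
  qf-transfer ψ A (vars⊆X ∘ xs⊆xs++ys _ _) satψ , qf-transfer χ A (vars⊆X ∘ xs⊆ys++xs _ _) satχ
qf-transfer (or ψ χ)  A vars⊆X (inj₁ satψ) = inj₁ (qf-transfer ψ A (vars⊆X ∘ xs⊆xs++ys _ _) satψ)
qf-transfer (or ψ χ)  A vars⊆X (inj₂ satχ) = inj₂ (qf-transfer χ A (vars⊆X ∘ xs⊆ys++xs _ _) satχ)

update-cases : ∀ {X} (s s' : Var → Loc) x ℓ ℓ' {z} → z ∈ x ∷ X →
  ((s [ x ↦ ℓ ]) ⊗ (s' [ x ↦ ℓ' ])) z ≡ (ℓ , ℓ') ⊎ (z ∈ X × ((s [ x ↦ ℓ ]) ⊗ (s' [ x ↦ ℓ' ])) z ≡ (s ⊗ s') z)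
update-cases s s' x ℓ ℓ' {z} z∈x∷X with z ≟ x | z∈x∷X
... | yes _   | _          = inj₁ refl
... | no  z≢x | here z≡x   = contradiction z≡x z≢x
... | no  _   | there z∈X  = inj₂ (z∈X , refl)

update-elim : ∀ {X} {s s' : Var → Loc} {x ℓ ℓ'} (P : Loc × Loc → Set) →
  P (ℓ , ℓ') → (∀ z → z ∈ X → P ((s ⊗ s') z)) →
  ∀ z → z ∈ x ∷ X → P (((s [ x ↦ ℓ ]) ⊗ (s' [ x ↦ ℓ' ])) z)
update-elim {s = s} {s'} {x} {ℓ} {ℓ'} P new old z z∈x∷X with update-cases s s' x ℓ ℓ' z∈x∷X
... | inj₁ e          = subst P (sym e) new
... | inj₂ (z∈X , e)  = subst P (sym e) (old z z∈X)

-- (ℓ, ℓ') may be assigned to a new variable while keeping agreement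
Compatible : ∀ {k} → Heap k → List Var → (Var → Loc) → (Var → Loc) → Loc × Loc → Set
Compatible h X s s' p = Faithful h p × (∀ z → z ∈ X → Coherent p ((s ⊗ s') z))

agree-extend : ∀ {k} {h : Heap k} {X s s' x ℓ ℓ'} → Agree h X s s' →
  Compatible h X s s' (ℓ , ℓ') → Agree h (x ∷ X) (s [ x ↦ ℓ ]) (s' [ x ↦ ℓ' ])
agree-extend {h = h} {X} {s} {s'} {x} {ℓ} {ℓ'} A (new-faithful , new-coherent) = record
  { coherent = λ y z y∈ z∈ →
      update-elim (λ p → Coherent p (((s [ x ↦ ℓ ]) ⊗ (s' [ x ↦ ℓ' ])) z))
        (update-elim (Coherent (ℓ , ℓ')) (coherent-refl _) new-coherent z z∈)
        (λ y y∈X → update-elim (Coherent ((s ⊗ s') y))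
           (coherent-sym (new-coherent y y∈X)) (λ z z∈X → coherent A y z y∈X z∈X) z z∈)
        y y∈
  ; faithful = update-elim (Faithful h) new-faithful (faithful A) }

variable-compatible : ∀ {k} {h : Heap k} {X s s'} → Agree h X s s' →
  ∀ y → y ∈ X → Compatible h X s s' ((s ⊗ s') y)
variable-compatible A y y∈X = faithful A y y∈X , λ z → coherent A y z y∈X

element-compatible : ∀ {k} {h : Heap k} {X s s' ℓ} → Agree h X s s' →
  InElems h ℓ → Compatible h X s s' (ℓ , ℓ)
element-compatible {h = h} A ℓ∈elems = (λ _ → refl) , λ z z∈X →
    (λ ℓ≡sz  → trans ℓ≡sz (faithful A z z∈X (inj₁ (subst (InElems h) ℓ≡sz ℓ∈elems))))
  , (λ ℓ≡s'z → trans ℓ≡s'z (sym (faithful A z z∈X (inj₂ (subst (InElems h) ℓ≡s'z ℓ∈elems)))))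

fresh-compatible : ∀ {k} {h : Heap k} {X s s' ℓ ℓ'} →
  ¬ InElems h ℓ → ¬ InElems h ℓ' →
  (∀ z → z ∈ X → ¬ s z ≡ ℓ) → (∀ z → z ∈ X → ¬ s' z ≡ ℓ') → Compatible h X s s' (ℓ , ℓ')
fresh-compatible ℓ∉elems ℓ'∉elems ℓ-unnamed ℓ'-unnamed =
    Sum.[ (λ el → contradiction el ℓ∉elems) , (λ el → contradiction el ℓ'∉elems) ]
  , λ z z∈X → (λ ℓ≡sz → contradiction (sym ℓ≡sz) (ℓ-unnamed z z∈X))
            , (λ ℓ'≡s'z → contradiction (sym ℓ'≡s'z) (ℓ'-unnamed z z∈X))

room-fresh : ∀ {k} {h : Heap k} {U N} → OutsideAtLeast U h N → (M : List Loc) →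
  length M < N → ∃ λ ℓ → U ℓ × ¬ InElems h ℓ × ℓ ∉ M
room-fresh (L , uniqueL , refl , unused) M M<L =
  let (ℓ , ℓ∈L , ℓ∉M) = outside L M uniqueL M<L
      (uℓ , ℓ∉elems)  = All.lookup unused ℓ∈L
  in ℓ , uℓ , ℓ∉elems , ℓ∉M

-- The invariant of the quantifier induction: agreement on X, stores and
-- heap elements inside the universes, and n + |X| unused locations on
-- each side, n being the number of quantifiers left.
record Correspondence {k} (h : Heap k) (U U' : Loc → Set) (n : ℕ) (X : List Var)
                      (s s' : Var → Loc) : Set where
  field
    agree   : Agree h X s s'
    stored  : ∀ z → z ∈ X → U (s z) × U' (s' z)
    elemsU  : ∀ ℓ → InElems h ℓ → U ℓ
    elemsU' : ∀ ℓ → InElems h ℓ → U' ℓ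
    finite  : FiniteDom h
    room    : OutsideAtLeast U  h (n + length X)
    room'   : OutsideAtLeast U' h (n + length X)
open Correspondence

-- the invariant is symmetric, which reduces ∀ to the ∃ direction
correspondence-sym : ∀ {k} {h : Heap k} {U U' n X s s'} →
  Correspondence h U U' n X s s' → Correspondence h U' U n X s' s
correspondence-sym C = record
  { agree   = agree-sym (agree C)
  ; stored  = λ z z∈X → swap (stored C z z∈X)
  ; elemsU  = elemsU' C
  ; elemsU' = elemsU C
  ; finite  = finite C
  ; room    = room' C
  ; room'   = room C }

-- Every choice on the left has a compatible partner on the right: the
-- location of a variable naming ℓ, ℓ itself if it is a heap element, and
-- otherwise a fresh location, which exists as one quantifier is left.
partner : ∀ {k} {h : Heap k} {U U' n X s s'} → Correspondence h U U' (suc n) X s s' →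
  ∀ ℓ → U ℓ → ∃ λ ℓ' → U' ℓ' × Compatible h X s s' (ℓ , ℓ')
partner {h = h} {n = n} {X} {s} {s'} C ℓ uℓ
  with any? (λ y → s y ≟ ℓ) X | inElems? h (proj₁ (finite C)) (proj₂ (finite C)) ℓ
... | yes named | _ =
  let (y , y∈X , sy≡ℓ) = find named in
  s' y , proj₂ (stored C y y∈X) ,
  subst (λ a → Compatible h X s s' (a , s' y)) sy≡ℓ (variable-compatible (agree C) y y∈X)
... | no _ | yes ℓ∈elems = ℓ , elemsU' C ℓ ℓ∈elems , element-compatible (agree C) ℓ∈elems
... | no unnamed | no ℓ∉elems =
  let (ℓ' , uℓ' , ℓ'∉elems , ℓ'∉s'X) = room-fresh (room' C) (map s' X) fewer in
  ℓ' , uℓ' , fresh-compatible ℓ∉elems ℓ'∉elems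
    (λ z z∈X sz≡ℓ → unnamed (lose z∈X sz≡ℓ))
    (λ z z∈X s'z≡ℓ' → ℓ'∉s'X (subst (_∈ map s' X) s'z≡ℓ' (∈-map⁺ s' z∈X)))
  where
  fewer : length (map s' X) < suc n + length X
  fewer = subst (_< suc n + length X) (sym (length-map s' X)) (s≤s (m≤n+m (length X) n))

correspondence-extend : ∀ {k} {h : Heap k} {U U' n X s s' x ℓ ℓ'} →
  Correspondence h U U' (suc n) X s s' → U ℓ → U' ℓ' → Compatible h X s s' (ℓ , ℓ') →
  Correspondence h U U' n (x ∷ X) (s [ x ↦ ℓ ]) (s' [ x ↦ ℓ' ])
correspondence-extend {h = h} {U} {U'} {n} {X} C uℓ uℓ' compat = record
  { agree   = agree-extend (agree C) compat
  ; stored  = update-elim (λ (a , a') → U a × U' a') (uℓ , uℓ') (stored C)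
  ; elemsU  = elemsU C
  ; elemsU' = elemsU' C
  ; finite  = finite C
  ; room    = subst (OutsideAtLeast U  h) (sym (+-suc n (length X))) (room C)
  ; room'   = subst (OutsideAtLeast U' h) (sym (+-suc n (length X))) (room' C) }

scope-⊆ : ∀ x (V X : List Var) → filter (λ y → ¬? (y ≟ x)) V ⊆ X → V ⊆ x ∷ X
scope-⊆ x V X bound⊆X {z} z∈V with z ≟ x
... | yes z≡x = here z≡x
... | no  z≢x = there (bound⊆X (∈-filter⁺ (λ y → ¬? (y ≟ x)) z∈V z≢x))

sat-transfer : ∀ {k} {h : Heap k} {U U' X s s'} (φ : Prenex k) →
  Correspondence h U U' (nQuant φ) X s s' → fv φ ⊆ X → Sat U s h φ → Sat U' s' h φ
sat-transfer (qf ψ) C fv⊆X sat = qf-transfer ψ (agree C) fv⊆X sat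
sat-transfer {X = X} (all x φ) C fv⊆X sat ℓ' uℓ' =
  let C⁻¹ = correspondence-sym C
      (ℓ , uℓ , compat) = partner C⁻¹ ℓ' uℓ'
  in sat-transfer φ (correspondence-sym (correspondence-extend C⁻¹ uℓ' uℓ compat))
       (scope-⊆ x (fv φ) X fv⊆X) (sat ℓ uℓ)
sat-transfer {X = X} (ex x φ) C fv⊆X (ℓ , uℓ , sat) =
  let (ℓ' , uℓ' , compat) = partner C ℓ uℓ
  in ℓ' , uℓ' , sat-transfer φ (correspondence-extend C uℓ uℓ' compat)
                  (scope-⊆ x (fv φ) X fv⊆X) sat

module _ {k : ℕ} {h h' : Heap k} (same : ∀ ℓ → h ℓ ≡ h' ℓ) where

  dom-ext : ∀ {ℓ} → InDom h ℓ → InDom h' ℓ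
  dom-ext {ℓ} (v , ℓ↦v) = v , trans (sym (same ℓ)) ℓ↦v

  elems-ext : ∀ {ℓ} → InElems h ℓ → InElems h' ℓ
  elems-ext (inj₁ ℓ∈dom)                = inj₁ (dom-ext ℓ∈dom)
  elems-ext (inj₂ (ℓ₀ , v , ℓ₀↦v , ℓ∈v)) = inj₂ (ℓ₀ , v , trans (sym (same ℓ₀)) ℓ₀↦v , ℓ∈v)

test-heap-ext : ∀ {k} {h h' : Heap k} (s : Var → Loc) (t : Test k) →
  (∀ ℓ → h ℓ ≡ h' ℓ) → ⟦ t ⟧T s h → ⟦ t ⟧T s h'
test-heap-ext s (eq x y)         same x≡y  = x≡y
test-heap-ext s (pto x ys)       same x↦ys = trans (sym (same (s x))) x↦ys
test-heap-ext s (alloc x)        same x∈dom = dom-ext same x∈dom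
test-heap-ext s (size≥ (fin n))  same (l , uniq , len , l⊆dom) = l , uniq , len , All.map (dom-ext same) l⊆dom
test-heap-ext s (size≥ ∞)        same ()

qf-heap-ext : ∀ {k} {h h' : Heap k} (s : Var → Loc) (ψ : QF k) →
  (∀ ℓ → h ℓ ≡ h' ℓ) → ⟦ ψ ⟧Q s h → ⟦ ψ ⟧Q s h'
qf-heap-ext s (atom t)  same sat = test-heap-ext s t same sat
qf-heap-ext s tt        same sat = tt
qf-heap-ext s ff        same ()
qf-heap-ext s (not ψ)   same sat = λ sat' → sat (qf-heap-ext s ψ (λ ℓ → sym (same ℓ)) sat')
qf-heap-ext s (and ψ χ) same (satψ , satχ) = qf-heap-ext s ψ same satψ , qf-heap-ext s χ same satχ
qf-heap-ext s (or ψ χ)  same (inj₁ satψ) = inj₁ (qf-heap-ext s ψ same satψ)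
qf-heap-ext s (or ψ χ)  same (inj₂ satχ) = inj₂ (qf-heap-ext s χ same satχ)

sat-heap-ext : ∀ {k} {h h' : Heap k} (U : Loc → Set) (s : Var → Loc) (φ : Prenex k) →
  (∀ ℓ → h ℓ ≡ h' ℓ) → Sat U s h φ → Sat U s h' φ
sat-heap-ext U s (qf ψ)    same sat = qf-heap-ext s ψ same sat
sat-heap-ext U s (all x φ) same sat = λ ℓ uℓ → sat-heap-ext U (s [ x ↦ ℓ ]) φ same (sat ℓ uℓ)
sat-heap-ext U s (ex x φ)  same (ℓ , uℓ , sat) = ℓ , uℓ , sat-heap-ext U (s [ x ↦ ℓ ]) φ same sat

proposition1 : ∀ {k} → 1 ≤ k → (φ : Prenex k) → (I I' : Structure k) →
    StoreIn I (freeVars φ) → StoreIn I' (freeVars φ) →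
    Equiv (freeVars φ) (nQuant φ) I I' →
    I ⊨ φ → I' ⊨ φ
proposition1 _ φ I I' storeI storeI' E I⊨φ =
  sat-heap-ext (U I') (store I') φ sameHeap
    (sat-transfer φ initial (∈-deduplicate⁺ _≟_) I⊨φ)
  where
  open Equiv E
  initial : Correspondence (heap I) (U I) (U I') (nQuant φ) (freeVars φ) (store I) (store I')
  initial = record
    { agree   = record { coherent = sameEqs ; faithful = sameElems }
    ; stored  = λ z z∈V → storeI z z∈V , storeI' z z∈V
    ; elemsU  = heapInU I
    ; elemsU' = λ ℓ ℓ∈elems → heapInU I' ℓ (elems-ext sameHeap ℓ∈elems)
    ; finite  = heapFinite I
    ; room    = bigU
    ; room'   = bigU' }
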